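{- The conditional dependence atom is not definable in LFD: there exist a set $V$ of variables, a relational vocabulary, an LFD formula $\varphi$, a finite $X\subseteq V$ and $y\in V$ such that no LFD formula $\psi$ satisfies, for every dependence model $\mathbf{M}$ and every $s\in A$, $\mathbf{M},s\models\psi$ iff $\mathbf{M},s\models D^\varphi_X y$.
   Context: A dependence model over variables $V$ and a relational vocabulary is $\mathbf{M}=(O,I,A)$ with $O$ a set of objects, $I(P)\subseteq O^n$ for each $n$-ary predicate $P$, and $A\subseteq O^V$ a set of admissible assignments; $s=_X t$ means $s(x)=t(x)$ for all $x\in X$. LFD formulas: $\varphi::=P\mathbf{x}\mid\neg\varphi\mid\varphi\wedge\varphi\mid\mathbb{D}_X\varphi\mid D_X y$ ($X$ finite, $y\in V$), with semantics at $s\in A$: $P\mathbf{x}$ iff $s(\mathbf{x})\in I(P)$; Booleans as usual; $\mathbb{D}_X\varphi$ iff $t\models\varphi$ for all $t\in A$ with $s=_X t$; $D_Xy$ iff for all $t\in A$, $s=_X t$ implies $s(y)=t(y)$. The conditional dependence atom $D^\varphi_X y$ is interpreted by: $s\models D^\varphi_X y$ iff for all $t\in A$, if $t\models\varphi$ and $s=_X t$ then $s(y)=t(y)$. -}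

module Defs where

open import Data.Nat using (ℕ)
open import Data.Fin using (Fin)
open import Data.List using (List)
open import Data.List.Membership.Propositional using (_∈_)
open import Data.Product using (_×_)
open import Relation.Nullary using (¬_)
open import Relation.Binary.PropositionalEquality using (_≡_)
open import Function using (_∘_)

record Vocab : Set₁ where
  field
    Pred  : Set
    arity : Pred → ℕ
open Vocab public

-- LFD formulas over variables V and vocabulary σ.
-- Finite sets X of variables are represented by lists.
data Form (V : Set) (σ : Vocab) : Set where
  atom : (P : Pred σ) → (Fin (arity σ P) → V) → Form V σ
  neg  : Form V σ → Form V σ
  conj : Form V σ → Form V σ → Form V σ
  𝔻    : List V → Form V σ → Form V σ
  Dep  : List V → V → Form V σ

record Model (V : Set) (σ : Vocab) : Set₁ where
  field
    O : Set
    I : (P : Pred σ) → (Fin (arity σ P) → O) → Set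
    A : (V → O) → Set
open Model public

_=[_]_ : {V O : Set} → (V → O) → List V → (V → O) → Set
s =[ X ] t = ∀ x → x ∈ X → s x ≡ t x

Sat : {V : Set} {σ : Vocab} (M : Model V σ) → (V → O M) → Form V σ → Set
Sat M s (atom P xs) = I M P (s ∘ xs)
Sat M s (neg φ)     = ¬ Sat M s φ
Sat M s (conj φ ψ)  = Sat M s φ × Sat M s ψ
Sat M s (𝔻 X φ)     = ∀ t → A M t → s =[ X ] t → Sat M t φ
Sat M s (Dep X y)   = ∀ t → A M t → s =[ X ] t → s y ≡ t y

SatCondDep : {V : Set} {σ : Vocab} (M : Model V σ) → (V → O M) →
             Form V σ → List V → V → Set
SatCondDep M s φ X y = ∀ t → A M t → Sat M t φ → s =[ X ] t → s y ≡ t y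

-- LFD truth is invariant under atom-preserving surjections between full models
-- with at least two objects: the 𝔻 clause is matched by lifting assignments along a
-- section, and plain dependence atoms hold exactly when y ∈ X on both sides.  The
-- projection Bool × Bool → Bool with P = {true} × Bool over P = {true} is such a
-- surjection, yet D^{P v}_∅ v ("all P-points agree on v") holds in the target and
-- fails in the source, so no LFD formula can express it.
module Submission where

open import Defs
open import Data.Bool using (Bool; true; false; not)
open import Data.Bool.Properties using (not-¬)
open import Data.Fin using (zero)
open import Data.List using (List; [])
open import Data.List.Membership.Propositional using (_∈_; _∉_)
import Data.List.Membership.DecPropositional as DecMembership
open import Data.Product using (Σ; _×_; _,_; proj₁; proj₂)
open import Data.Product.Function.NonDependent.Propositional using (_×-⇔_)
open import Data.Unit using (⊤; tt)
import Data.Unit.Properties as ⊤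
open import Function using (_∘_)
open import Function.Bundles using (_⇔_; mk⇔; Equivalence)
open import Function.Properties.Equivalence using () renaming (sym to ⇔-sym; trans to ⇔-trans)
open import Function.Related.TypeIsomorphisms using (¬-cong-⇔)
open import Relation.Binary.Definitions using (DecidableEquality)
open import Relation.Binary.PropositionalEquality using (_≡_; _≢_; refl; sym; trans; cong)
open import Relation.Nullary using (¬_; yes; no; contradiction)

Full : {V : Set} {σ : Vocab} → Model V σ → Set
Full M = ∀ s → A M s

FixedPointFreeMap : Set → Set
FixedPointFreeMap O = Σ (O → O) λ other → ∀ o → o ≢ other o

-- Stated relationally (map ∘ xs agreeing pointwise with ys) to avoid function
-- extensionality.
record AtomSurjection {V : Set} {σ : Vocab} (M N : Model V σ) : Set where
  field
    map             : O M → O N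
    section         : O N → O M
    map∘section     : ∀ o → map (section o) ≡ o
    atom-preserving : ∀ P xs ys → (∀ i → map (xs i) ≡ ys i) → I M P xs ⇔ I N P ys

module _ {V : Set} {σ : Vocab} (_≟_ : DecidableEquality V) where

  open DecMembership _≟_ using (_∈?_)

  module _ {O : Set} where

    patch : List V → (V → O) → (V → O) → V → O
    patch X s r x with x ∈? X
    ... | yes _ = s x
    ... | no  _ = r x

    patch-elim : (P : O → Set) (X : List V) (s r : V → O) (x : V) →
                 (x ∈ X → P (s x)) → (x ∉ X → P (r x)) → P (patch X s r x)
    patch-elim P X s r x inside outside with x ∈? X
    ... | yes x∈X = inside x∈X
    ... | no  x∉X = outside x∉X

    patch-agrees : (X : List V) (s r : V → O) → s =[ X ] patch X s r
    patch-agrees X s r x x∈X =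
      patch-elim (s x ≡_) X s r x (λ _ → refl) (contradiction x∈X)

    patch-outside : (X : List V) (s r : V → O) (x : V) → x ∉ X → patch X s r x ≡ r x
    patch-outside X s r x x∉X =
      patch-elim (_≡ r x) X s r x (λ x∈X → contradiction x∈X x∉X) (λ _ → refl)

  Dep⇔∈ : (M : Model V σ) → Full M → FixedPointFreeMap (O M) →
          (s : V → O M) (X : List V) (y : V) → Sat M s (Dep X y) ⇔ y ∈ X
  Dep⇔∈ M full (other , other-moves) s X y = mk⇔ dependent (λ y∈X t _ s=t → s=t y y∈X)
    where
    dependent : Sat M s (Dep X y) → y ∈ X
    dependent dep with y ∈? X
    ... | yes y∈X = y∈X
    ... | no  y∉X = contradiction (trans (dep t (full t) (patch-agrees X s r)) (patch-outside X s r y y∉X))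
                                  (other-moves (s y))
      where
      r : V → O M
      r = other ∘ s
      t : V → O M
      t = patch X s r

  module _ (M N : Model V σ) (fullM : Full M) (fullN : Full N)
           (movesM : FixedPointFreeMap (O M)) (movesN : FixedPointFreeMap (O N))
           (h : AtomSurjection M N) where

    open AtomSurjection h

    Sat-transfer : (ψ : Form V σ) (s : V → O M) (w : V → O N) →
                   (∀ x → map (s x) ≡ w x) → Sat M s ψ ⇔ Sat N w ψ
    Sat-transfer (atom P xs) s w s~w = atom-preserving P (s ∘ xs) (w ∘ xs) (s~w ∘ xs)
    Sat-transfer (neg ψ)     s w s~w = ¬-cong-⇔ (Sat-transfer ψ s w s~w)
    Sat-transfer (conj ψ χ)  s w s~w = Sat-transfer ψ s w s~w ×-⇔ Sat-transfer χ s w s~w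
    Sat-transfer (Dep X y)   s w s~w =
      ⇔-trans (Dep⇔∈ M fullM movesM s X y) (⇔-sym (Dep⇔∈ N fullN movesN w X y))
    Sat-transfer (𝔻 X ψ)     s w s~w = mk⇔ forth back
      where
      -- A successor t′ of w is matched by the assignment that agrees with s on X
      -- and is lifted along the section elsewhere.
      forth : Sat M s (𝔻 X ψ) → Sat N w (𝔻 X ψ)
      forth H t′ _ w=t′ = Equivalence.to (Sat-transfer ψ t t′ t~t′) (H t (fullM t) (patch-agrees X s r))
        where
        r : V → O M
        r = section ∘ t′
        t : V → O M
        t = patch X s r
        t~t′ : ∀ x → map (t x) ≡ t′ x
        t~t′ x = patch-elim (λ o → map o ≡ t′ x) X s r x
          (λ x∈X → trans (s~w x) (w=t′ x x∈X)) (λ _ → map∘section (t′ x))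

      back : Sat N w (𝔻 X ψ) → Sat M s (𝔻 X ψ)
      back H t _ s=t = Equivalence.from (Sat-transfer ψ t (map ∘ t) (λ _ → refl))
        (H (map ∘ t) (fullN (map ∘ t)) (λ x x∈X → trans (sym (s~w x)) (cong map (s=t x x∈X))))

-- One variable and one unary predicate P; the conditional atom D^{P v}_∅ v says
-- that P has at most one element.
unary : Vocab
unary = record { Pred = ⊤ ; arity = λ _ → 1 }

Pv : Form ⊤ unary
Pv = atom tt (λ _ → tt)

Bools : Model ⊤ unary
Bools = record { O = Bool ; I = λ _ xs → xs zero ≡ true ; A = λ _ → ⊤ }

BoolPairs : Model ⊤ unary
BoolPairs = record { O = Bool × Bool ; I = λ _ xs → proj₁ (xs zero) ≡ true ; A = λ _ → ⊤ }

not-moves : FixedPointFreeMap Bool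
not-moves = not , λ b → not-¬ refl

not-first-moves : FixedPointFreeMap (Bool × Bool)
not-first-moves = (λ (b , c) → not b , c) , λ (b , c) → proj₂ not-moves b ∘ cong proj₁

first-projection : AtomSurjection BoolPairs Bools
first-projection = record
  { map             = proj₁
  ; section         = λ b → b , false
  ; map∘section     = λ _ → refl
  ; atom-preserving = λ _ _ _ eq → mk⇔ (trans (sym (eq zero))) (trans (eq zero))
  }

condDep-Bools : SatCondDep Bools (λ _ → true) Pv [] tt
condDep-Bools t _ t∈P _ = sym t∈P

¬condDep-BoolPairs : ¬ SatCondDep BoolPairs (λ _ → true , false) Pv [] tt
¬condDep-BoolPairs cd with cd (λ _ → true , true) tt refl (λ _ ())
... | ()

fact6p15 : Σ Set λ V → Σ Vocab λ σ → Σ (Form V σ) λ φ → Σ (List V) λ X → Σ V λ y →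
    ¬ (Σ (Form V σ) λ ψ →
        (M : Model V σ) → (s : V → O M) → A M s →
          (Sat M s ψ ⇔ SatCondDep M s φ X y))
fact6p15 = ⊤ , unary , Pv , [] , tt , λ (ψ , defines) →
  let inBools     = Equivalence.from (defines Bools (λ _ → true) tt) condDep-Bools
      inBoolPairs = Equivalence.from (transfer ψ (λ _ → true , false) (λ _ → true) (λ _ → refl)) inBools
  in ¬condDep-BoolPairs (Equivalence.to (defines BoolPairs _ tt) inBoolPairs)
  where
  transfer : (ψ : Form ⊤ unary) (s : ⊤ → Bool × Bool) (w : ⊤ → Bool) →
             (∀ x → proj₁ (s x) ≡ w x) → Sat BoolPairs s ψ ⇔ Sat Bools w ψ
  transfer = Sat-transfer ⊤._≟_ BoolPairs Bools (λ _ → tt) (λ _ → tt)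
               not-first-moves not-moves first-projection
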